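{- Let $G=(U,V;E)$ be a finite bipartite graph in which every vertex $r\in U\cup V$ has a strict total order $\succ_r$ on its set of neighbors $N_G(r)$. For $U'\subseteq U$, let $F(U')\subseteq V$ be the set of vertices of $V$ that are matched in a stable matching of the restricted instance on the induced subgraph $G[U'\cup V]$ (with preferences restricted accordingly). Let $\mathcal{F}=\{F(U')\mid U'\subseteq U\}$. Then $(V,\mathcal{F})$ is an antimatroid.
   Context: A matching $M\subseteq E$ is a set of edges no two of which share a vertex; for $(u,v)\in M$ write $M(u)=v$, $M(v)=u$. An edge $(u,v)$ of a graph $H$ is a blocking pair against a matching $M$ of $H$ if ($u$ is unmatched in $M$ or $v\succ_u M(u)$) and ($v$ is unmatched in $M$ or $u\succ_v M(v)$); $M$ is stable in $H$ if no edge of $H$ is a blocking pair. In the restricted instance on $G[U'\cup V]$ (the subgraph induced by $U'\cup V$), each vertex's preference is the restriction of its original order to its neighbors in that subgraph. Stable matchings always exist and all stable matchings of an instance match the same vertex set, so $F(U')$ is well defined (e.g., it is the set of $V$-vertices matched by the output of the $U$-proposing deferred acceptance algorithm on the restricted instance). A set system $(V,\mathcal{F})$ with $\mathcal{F}\subseteq 2^V$ is an antimatroid if $\mathcal{F}\neq\emptyset$, every nonempty $X\in\mathcal{F}$ has an element $e\in X$ with $X\setminus\{e\}\in\mathcal{F}$ (accessibility), and $X,Y\in\mathcal{F}$ implies $X\cup Y\in\mathcal{F}$ (union-closedness). -}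

module Defs where

open import Data.Nat using (ℕ)
open import Data.Fin using (Fin)
open import Data.Fin.Subset using (Subset; _∈_; _∪_; _-_; Nonempty)
open import Data.Product using (Σ; ∃; ∃-syntax; _×_; _,_)
open import Data.Sum using (_⊎_)
open import Relation.Nullary using (¬_)
open import Relation.Binary.PropositionalEquality using (_≡_; _≢_)
open import Relation.Binary using (Decidable)
open import Function.Bundles using (_⇔_)

record IsStrictTotalOn {A : Set} (N : A → Set) (_≻_ : A → A → Set) : Set where
  field
    irrefl  : ∀ {x} → N x → ¬ (x ≻ x)
    trans   : ∀ {x y z} → N x → N y → N z → x ≻ y → y ≻ z → x ≻ z
    connex  : ∀ {x y} → N x → N y → x ≢ y → (x ≻ y) ⊎ (y ≻ x)

-- A finite bipartite graph G = (U, V; E) with U = Fin m, V = Fin n,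
-- and strict preference orders of every vertex on its neighbours.
-- prefU u v w  means  v ≻_u w ;  prefV v u u'  means  u ≻_v u'.
record Instance (m n : ℕ) : Set₁ where
  field
    E      : Fin m → Fin n → Set
    E?     : Decidable E
    prefU  : Fin m → Fin n → Fin n → Set
    prefU? : ∀ u → Decidable (prefU u)
    prefV  : Fin n → Fin m → Fin m → Set
    prefV? : ∀ v → Decidable (prefV v)
    prefU-order : ∀ u → IsStrictTotalOn (λ v → E u v) (prefU u)
    prefV-order : ∀ v → IsStrictTotalOn (λ u → E u v) (prefV v)

module _ {m n : ℕ} (I : Instance m n) where
  open Instance I

  EdgeIn : Subset m → Fin m → Fin n → Set
  EdgeIn U' u v = (u ∈ U') × E u v

  record IsMatching (U' : Subset m) (M : Fin m → Fin n → Set) : Set where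
    field
      edges  : ∀ {u v} → M u v → EdgeIn U' u v
      uniqU  : ∀ {u v v'} → M u v → M u v' → v ≡ v'
      uniqV  : ∀ {u u' v} → M u v → M u' v → u ≡ u'

  -- (u is unmatched in M or v ≻_u M(u))
  PrefersU : (M : Fin m → Fin n → Set) → Fin m → Fin n → Set
  PrefersU M u v = ∀ w → M u w → prefU u v w

  -- (v is unmatched in M or u ≻_v M(v))
  PrefersV : (M : Fin m → Fin n → Set) → Fin m → Fin n → Set
  PrefersV M u v = ∀ w → M w v → prefV v u w

  Blocking : Subset m → (Fin m → Fin n → Set) → Fin m → Fin n → Set
  Blocking U' M u v = EdgeIn U' u v × PrefersU M u v × PrefersV M u v

  IsStable : Subset m → (Fin m → Fin n → Set) → Set
  IsStable U' M = IsMatching U' M × (∀ u v → ¬ Blocking U' M u v)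

  MatchedV : (Fin m → Fin n → Set) → Subset n → Set
  MatchedV M X = ∀ v → (v ∈ X) ⇔ (∃[ u ] M u v)

  IsF : Subset m → Subset n → Set₁
  IsF U' X = ∃[ M ] (IsStable U' M × MatchedV M X)

  𝓕 : Subset n → Set₁
  𝓕 X = ∃[ U' ] IsF U' X

record IsAntimatroid {n : ℕ} (𝓕 : Subset n → Set₁) : Set₁ where
  field
    nonempty      : ∃[ X ] 𝓕 X
    accessible    : ∀ X → 𝓕 X → Nonempty X → ∃[ e ] (e ∈ X × 𝓕 (X - e))
    union-closed  : ∀ X Y → 𝓕 X → 𝓕 Y → 𝓕 (X ∪ Y)

module Submission where

-- Represent F(U') by a stable matching seen from V. For union-closedness, run U-proposing deferred
-- acceptance starting from a stable matching τ of Y, where every vertex matched in X or Y may propose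
-- only to the top segment of its list lying inside X ∪ Y. Receivers only trade up, so Y stays matched;
-- and a vertex of X left unmatched would make "σ-partner of the final partner" (σ the matching of X)
-- an injective self-map of a finite set that misses a point. Hence the result is a stable matching
-- onto exactly X ∪ Y. For accessibility, pick v₀ ∈ X, delete its partner u₀ and let V propose,
-- starting from the rest of the matching: the same injectivity argument shows that exactly one vertex
-- e of X ends up unmatched, and the result witnesses X - e ∈ 𝓕.

open import Defs
open import Data.Bool using (Bool; true; false; T; if_then_else_; _∧_; _∨_)
open import Data.Bool.Properties using (T-∧; T-∨)
open import Data.Empty using (⊥; ⊥-elim)
open import Data.Fin using (Fin; zero; suc; _≟_; toℕ)
open import Data.Fin.Properties using (any?; all?; ¬∀⟶∃¬; pigeonhole; suc-injective)
import Data.Fin.Subset as Subset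
open import Data.Fin.Subset using (Subset; _∈_; _∉_; _∪_; _-_; _─_; inside; outside)
open import Data.Fin.Subset.Properties
  using (_∈?_; x∈p∪q⁺; x∈p∪q⁻; x∈p∧x≢y⇒x∈p-y; p─q⊆p; x∈⁅x⁆; ∉⊥)
open import Data.List using (List; []; _∷_; allFin)
open import Data.List.Membership.Propositional using () renaming (_∈_ to _∈ₗ_; _∉_ to _∉ₗ_)
open import Data.List.Membership.Propositional.Properties using (∈-allFin)
open import Data.List.Relation.Unary.Any using (here; there)
open import Data.Maybe using (Maybe; just; nothing; is-just; fromMaybe; _>>=_)
open import Data.Maybe.Properties using (just-injective; ≡-dec)
open import Data.Nat using (ℕ; zero; suc; _+_; _*_; _≤_; _<_; z≤n; s≤s)
open import Data.Nat.Properties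
  using (+-mono-≤; +-mono-<-≤; +-mono-≤-<; +-monoˡ-≤; +-suc; +-identityʳ; *-identityʳ; ≤-refl; ≤-reflexive;
         <-irrefl; ≤-trans; <⇒≱; <-≤-trans; m≤n+m; n<1+n)
open import Data.Product using (∃; ∃-syntax; _×_; _,_; proj₁; proj₂)
open import Data.Sum using (_⊎_; inj₁; inj₂)
open import Data.Vec using (_∷_; here; there; tabulate)
open import Data.Vec.Properties using (lookup∘tabulate; lookup⇒[]=; []=⇒lookup)
open import Data.Vec.Functional using (updateAt)
open import Data.Vec.Functional.Properties using (updateAt-updates; updateAt-minimal)
open import Function using (_∘_; const)
open import Function.Bundles using (Equivalence; mk⇔)
open import Relation.Binary using (Decidable)
open import Relation.Binary.PropositionalEquality using (_≡_; _≢_; refl; sym; trans; cong; subst)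
open import Relation.Nullary using (¬_; Dec; yes; no; does; contradiction)
open import Relation.Nullary.Decidable
  using (_×-dec_; _⊎-dec_; _→-dec_; ¬?; T?; ⌊_⌋; dec-true; toWitness; fromWitness)

∑ : ∀ {k} → (Fin k → ℕ) → ℕ
∑ {zero}  f = 0
∑ {suc k} f = f zero + ∑ (f ∘ suc)

∑-mono-≤ : ∀ {k} {f g : Fin k → ℕ} → (∀ i → f i ≤ g i) → ∑ f ≤ ∑ g
∑-mono-≤ {zero}  f≤g = z≤n
∑-mono-≤ {suc k} f≤g = +-mono-≤ (f≤g zero) (∑-mono-≤ (f≤g ∘ suc))

∑-mono-< : ∀ {k} {f g : Fin k → ℕ} (j : Fin k) → (∀ i → i ≢ j → f i ≤ g i) → f j < g j → ∑ f < ∑ g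
∑-mono-< {suc k} zero    f≤g fⱼ<gⱼ = +-mono-<-≤ fⱼ<gⱼ (∑-mono-≤ (λ i → f≤g (suc i) λ ()))
∑-mono-< {suc k} (suc j) f≤g fⱼ<gⱼ =
  +-mono-≤-< (f≤g zero λ ()) (∑-mono-< j (λ i i≢j → f≤g (suc i) (i≢j ∘ suc-injective)) fⱼ<gⱼ)

∑-≤-* : ∀ {k} (f : Fin k → ℕ) {c} → (∀ i → f i ≤ c) → ∑ f ≤ k * c
∑-≤-* {zero}  f f≤c = z≤n
∑-≤-* {suc k} f f≤c = +-mono-≤ (f≤c zero) (∑-≤-* (f ∘ suc) (f≤c ∘ suc))

indicator : Bool → ℕ
indicator b = if b then 1 else 0

indicator≤1 : ∀ b → indicator b ≤ 1
indicator≤1 true  = ≤-refl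
indicator≤1 false = z≤n

indicator-mono : ∀ {x y} → (T x → T y) → indicator x ≤ indicator y
indicator-mono {false} x⇒y = z≤n
indicator-mono {true}  {true}  x⇒y = ≤-refl
indicator-mono {true}  {false} x⇒y = ⊥-elim (x⇒y _)

indicator-< : ∀ {x y} → ¬ T x → T y → indicator x < indicator y
indicator-< {false} {true} _ _ = ≤-refl
indicator-< {true}  ¬tx _ = ⊥-elim (¬tx _)

module _ {k} {S : Fin k → Set} (f : Fin k → Fin k) (f-closed : ∀ {x} → S x → S (f x))
         (f-injective : ∀ {x y} → S x → S y → f x ≡ f y → x ≡ y) {s} (Ss : S s) where

  private
    iterate : ℕ → Fin k
    iterate zero    = s
    iterate (suc i) = f (iterate i)

    S-iterate : ∀ i → S (iterate i)
    S-iterate zero    = Ss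
    S-iterate (suc i) = f-closed (S-iterate i)

  -- Injectivity on S walks any repetition among the iterates of s back to s itself.
  injectiveOn-omits-nothing : ¬ (∀ {x} → S x → f x ≢ s)
  injectiveOn-omits-nothing f-misses-s
    with i , j , i<j , fⁱ≡fʲ ← pigeonhole (n<1+n k) (iterate ∘ toℕ)
    = iterates-distinct (toℕ i) (toℕ j) (λ i≡j → <-irrefl i≡j i<j) fⁱ≡fʲ
    where
    iterates-distinct : ∀ i j → i ≢ j → iterate i ≢ iterate j
    iterates-distinct zero    zero    i≢j _ = i≢j refl
    iterates-distinct zero    (suc j) _   e = f-misses-s (S-iterate j) (sym e)
    iterates-distinct (suc i) zero    _   e = f-misses-s (S-iterate i) e
    iterates-distinct (suc i) (suc j) i≢j e =
      iterates-distinct i j (i≢j ∘ cong suc) (f-injective (S-iterate i) (S-iterate j) e)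

subsetOf : ∀ {k} {P : Fin k → Set} → (∀ i → Dec (P i)) → Subset k
subsetOf P? = tabulate (λ i → if does (P? i) then inside else outside)

∈-subsetOf⁺ : ∀ {k} {P : Fin k → Set} (P? : ∀ i → Dec (P i)) {i} → P i → i ∈ subsetOf P?
∈-subsetOf⁺ P? {i} p = lookup⇒[]= i _
  (trans (lookup∘tabulate _ i) (cong (λ b → if b then inside else outside) (dec-true (P? i) p)))

∈-subsetOf⁻ : ∀ {k} {P : Fin k → Set} (P? : ∀ i → Dec (P i)) {i} → i ∈ subsetOf P? → P i
∈-subsetOf⁻ P? {i} i∈P with P? i | trans (sym (lookup∘tabulate _ i)) ([]=⇒lookup i∈P)
... | yes p | _ = p
... | no _  | ()

x∈p─q⇒x∉q : ∀ {k} {p q : Subset k} {x} → x ∈ p ─ q → x ∉ q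
x∈p─q⇒x∉q {p = inside ∷ p} {outside ∷ q} here      ()
x∈p─q⇒x∉q {p = _ ∷ p}      {_ ∷ q}       (there m) (there x∈q) = x∈p─q⇒x∉q m x∈q

x∈p-y⇒x≢y : ∀ {k} {p : Subset k} {x y} → x ∈ p - y → x ≢ y
x∈p-y⇒x≢y x∈p-y refl = x∈p─q⇒x∉q x∈p-y (x∈⁅x⁆ _)

partialInverse : ∀ {k l} → (Fin k → Maybe (Fin l)) → Fin l → Maybe (Fin k)
partialInverse h y with any? (λ x → ≡-dec _≟_ (h x) (just y))
... | yes (x , _) = just x
... | no _        = nothing

partialInverse-sound : ∀ {k l} (h : Fin k → Maybe (Fin l)) {x y} → partialInverse h y ≡ just x → h x ≡ just y
partialInverse-sound h {x} {y} e with any? (λ x → ≡-dec _≟_ (h x) (just y))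
partialInverse-sound h refl | yes (_ , hx≡y) = hx≡y

partialInverse-complete : ∀ {k l} (h : Fin k → Maybe (Fin l)) →
  (∀ {x x' y} → h x ≡ just y → h x' ≡ just y → x ≡ x') →
  ∀ {x y} → h x ≡ just y → partialInverse h y ≡ just x
partialInverse-complete h h-injective {x} {y} hx≡y with any? (λ x → ≡-dec _≟_ (h x) (just y))
... | yes (x' , hx'≡y) = cong just (h-injective hx'≡y hx≡y)
... | no  ∄x           = ⊥-elim (∄x (x , hx≡y))

relay : ∀ {k l} → (Fin l → Maybe (Fin k)) → (Fin l → Maybe (Fin k)) → Fin k → Fin k
relay g h x = fromMaybe x (partialInverse g x >>= h)

relay-≡ : ∀ {k l} (g h : Fin l → Maybe (Fin k)) → (∀ {y y' x} → g y ≡ just x → g y' ≡ just x → y ≡ y') →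
          ∀ {x y x'} → g y ≡ just x → h y ≡ just x' → relay g h x ≡ x'
relay-≡ g h g-injective gy≡x hy≡x' rewrite partialInverse-complete g g-injective gy≡x | hy≡x' = refl

module _ {A : Set} {N : A → Set} {_≻_ : A → A → Set} (o : IsStrictTotalOn N _≻_) where
  open IsStrictTotalOn o renaming (trans to ≻-trans)

  IsStrictTotalOn-⊆ : {N' : A → Set} → (∀ {x} → N' x → N x) → IsStrictTotalOn N' _≻_
  IsStrictTotalOn-⊆ N'⊆N = record
    { irrefl = irrefl ∘ N'⊆N
    ; trans  = λ nx ny nz → ≻-trans (N'⊆N nx) (N'⊆N ny) (N'⊆N nz)
    ; connex = λ nx ny → connex (N'⊆N nx) (N'⊆N ny)
    }

  asym : ∀ {x y} → N x → N y → x ≻ y → ¬ y ≻ x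
  asym nx ny x≻y y≻x = irrefl nx (≻-trans nx ny nx x≻y y≻x)

module _ {k} {N : Fin k → Set} {_≻_ : Fin k → Fin k → Set}
         (≻? : Decidable _≻_) (o : IsStrictTotalOn N _≻_) where
  open IsStrictTotalOn o renaming (trans to ≻-trans)

  maximal : {C : Fin k → Set} → (∀ x → Dec (C x)) → (∀ {x} → C x → N x) →
            ∀ {x} → C x → ∃[ c ] (C c × ∀ {c'} → C c' → ¬ c' ≻ c)
  maximal {C} C? C⊆N Cx = scan (allFin k) Cx (λ {c'} _ c'∉ → ⊥-elim (c'∉ (∈-allFin c')))
    where
    scan : ∀ (xs : List (Fin k)) {c} → C c → (∀ {c'} → C c' → c' ∉ₗ xs → ¬ c' ≻ c) →
           ∃[ c ] (C c × ∀ {c'} → C c' → ¬ c' ≻ c)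
    scan []       Cc unseen-below = _ , Cc , λ Cc' → unseen-below Cc' λ ()
    scan (x ∷ xs) {c} Cc unseen-below with C? x
    ... | no ¬Cx = scan xs Cc λ {c'} Cc' c'∉ → unseen-below Cc' λ
          { (here refl) → ¬Cx Cc' ; (there c'∈) → c'∉ c'∈ }
    ... | yes Cx with ≻? x c
    ...   | no x⊁c = scan xs Cc below
      where
      below : ∀ {c'} → C c' → c' ∉ₗ xs → ¬ c' ≻ c
      below {c'} Cc' c'∉ with c' ≟ x
      ... | yes refl = x⊁c
      ... | no c'≢x  = unseen-below Cc' λ { (here e) → c'≢x e ; (there c'∈) → c'∉ c'∈ }
    ...   | yes x≻c = scan xs Cx below
      where
      below : ∀ {c'} → C c' → c' ∉ₗ xs → ¬ c' ≻ x
      below {c'} Cc' c'∉ c'≻x with c' ≟ x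
      ... | yes refl = irrefl (C⊆N Cx) c'≻x
      ... | no c'≢x  = unseen-below Cc' (λ { (here e) → c'≢x e ; (there c'∈) → c'∉ c'∈ })
                         (≻-trans (C⊆N Cc') (C⊆N Cx) (C⊆N Cc) c'≻x x≻c)

restrictEdges : ∀ {a b} (I : Instance a b) (A : Fin a → Fin b → Set) → Decidable A →
                (∀ {u v} → A u v → Instance.E I u v) → Instance a b
restrictEdges I A A? A⊆E = record
  { E = A ; E? = A? ; prefU = prefU ; prefU? = prefU? ; prefV = prefV ; prefV? = prefV?
  ; prefU-order = λ u → IsStrictTotalOn-⊆ (prefU-order u) A⊆E
  ; prefV-order = λ v → IsStrictTotalOn-⊆ (prefV-order v) A⊆E
  }
  where open Instance I

swap : ∀ {a b} → Instance a b → Instance b a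
swap I = record
  { E = λ v u → E u v ; E? = λ v u → E? u v ; prefU = prefV ; prefU? = prefV? ; prefV = prefU ; prefV? = prefU?
  ; prefU-order = prefV-order ; prefV-order = prefU-order
  }
  where open Instance I

-- The U-side of J proposes and its V-side receives.
module DeferredAcceptance {a b : ℕ} (J : Instance a b) where
  open Instance J

  record State : Set where
    constructor state
    field
      holder   : Fin b → Maybe (Fin a)
      rejected : Fin a → Fin b → Bool
  open State public

  record Invariant (s : State) : Set where
    field
      held-edge           : ∀ {p q} → holder s q ≡ just p → E p q
      holder-injective    : ∀ {p q q'} → holder s q ≡ just p → holder s q' ≡ just p → q ≡ q'
      rejected-for-better : ∀ {p q} → E p q → T (rejected s p q) →
                            ∃[ p' ] (holder s q ≡ just p' × prefV q p' p)
      rejected-above-held : ∀ {p q q'} → holder s q ≡ just p → E p q' → prefU p q' q → T (rejected s p q')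

  Final : State → Set
  Final s = ∀ p → (∃[ q ] holder s q ≡ just p) ⊎ (∀ q → E p q → T (rejected s p q))

  Improves : State → State → Set
  Improves s s' = ∀ {p q} → holder s q ≡ just p → ∃[ p' ] (holder s' q ≡ just p' × (p' ≡ p ⊎ prefV q p' p))

  Improves-refl : ∀ {s} → Improves s s
  Improves-refl h = _ , h , inj₁ refl

  Improves-trans : ∀ {s s' s''} → Invariant s → Invariant s' → Invariant s'' →
                   Improves s s' → Improves s' s'' → Improves s s''
  Improves-trans inv inv' inv'' s≤s' s'≤s'' h with s≤s' h
  ... | p' , h' , p'≥p with s'≤s'' h'
  ... | p'' , h'' , inj₁ refl = p'' , h'' , p'≥p
  ... | p'' , h'' , inj₂ p''>p' with p'≥p
  ...   | inj₁ refl = p'' , h'' , inj₂ p''>p'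
  ...   | inj₂ p'>p = p'' , h'' , inj₂ (IsStrictTotalOn.trans (prefV-order _)
                        (held-edge inv'' h'') (held-edge inv' h') (held-edge inv h) p''>p' p'>p)
    where open Invariant

  -- Each step either lets a free receiver hold a proposer or records a new rejection.
  load : State → Fin b → ℕ
  load s q = indicator (is-just (holder s q)) + ∑ λ p → indicator (rejected s p q)

  potential : State → ℕ
  potential s = ∑ (load s)

  potential-bounded : ∀ s → potential s ≤ b * suc a
  potential-bounded s = ∑-≤-* _ λ q → +-mono-≤ (indicator≤1 _)
    (≤-trans (∑-≤-* _ λ p → indicator≤1 (rejected s p q)) (≤-reflexive (*-identityʳ a)))

  opaque
    reject : Fin a → Fin b → (Fin a → Fin b → Bool) → Fin a → Fin b → Bool
    reject p q r p' q' = r p' q' ∨ (⌊ p' ≟ p ⌋ ∧ ⌊ q' ≟ q ⌋)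

    reject-keeps : ∀ {p q r p' q'} → T (r p' q') → T (reject p q r p' q')
    reject-keeps {p} {q} {r} {p'} {q'} t = Equivalence.from (T-∨ {r p' q'}) (inj₁ t)

    reject-adds : ∀ {p q r} → T (reject p q r p q)
    reject-adds {p} {q} {r} = Equivalence.from (T-∨ {r p q})
      (inj₂ (Equivalence.from T-∧ (fromWitness {a? = p ≟ p} refl , fromWitness {a? = q ≟ q} refl)))

    reject-view : ∀ {p q r p' q'} → T (reject p q r p' q') → (p' ≡ p × q' ≡ q) ⊎ T (r p' q')
    reject-view {p} {q} {r} {p'} {q'} t with Equivalence.to (T-∨ {r p' q'}) t
    ... | inj₁ old = inj₂ old
    ... | inj₂ new with Equivalence.to (T-∧ {⌊ p' ≟ p ⌋}) new
    ...   | p'≡p , q'≡q = inj₁ (toWitness {a? = p' ≟ p} p'≡p , toWitness {a? = q' ≟ q} q'≡q)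

  potential-reject : ∀ {s h p c} → (∀ q → T (is-just (holder s q)) → T (is-just (h q))) →
                     ¬ T (rejected s p c) → potential s < potential (state h (reject p c (rejected s)))
  potential-reject {s} {h} {p} {c} held-stays fresh = ∑-mono-< c (λ q _ → grows q) strict
    where
    s' = state h (reject p c (rejected s))
    grows : ∀ q → load s q ≤ load s' q
    grows q = +-mono-≤ (indicator-mono (held-stays q)) (∑-mono-≤ {a} λ p' → indicator-mono reject-keeps)
    strict : load s c < load s' c
    strict = +-mono-≤-< (indicator-mono (held-stays c))
      (∑-mono-< {a} p (λ p' _ → indicator-mono reject-keeps) (indicator-< fresh reject-adds))

  Step : State → Set
  Step s = ∃[ s' ] (Invariant s' × Improves s s' × potential s < potential s')

  module Propose {s} (inv : Invariant s) {p c} (p-free : ∀ q → holder s q ≢ just p)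
                 (edge : E p c) (fresh : ¬ T (rejected s p c))
                 (rejected-above : ∀ {q} → E p q → prefU p q c → T (rejected s p q)) where
    open Invariant inv

    accepted : Fin b → Maybe (Fin a)
    accepted = updateAt (holder s) c (const (just p))

    accepted-view : ∀ q → (q ≡ c × accepted q ≡ just p) ⊎ (q ≢ c × accepted q ≡ holder s q)
    accepted-view q with q ≟ c
    ... | yes refl = inj₁ (refl , updateAt-updates c (holder s))
    ... | no q≢c   = inj₂ (q≢c , updateAt-minimal q c (holder s) q≢c)

    accepted-edge : ∀ {p' q} → accepted q ≡ just p' → E p' q
    accepted-edge {q = q} h with accepted-view q
    ... | inj₁ (refl , e) = subst (λ x → E x c) (just-injective (trans (sym e) h)) edge
    ... | inj₂ (_ , e)    = held-edge (trans (sym e) h)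

    accepted-injective : ∀ {p' q q'} → accepted q ≡ just p' → accepted q' ≡ just p' → q ≡ q'
    accepted-injective {q = q} {q'} h h' with accepted-view q | accepted-view q'
    ... | inj₁ (refl , e) | inj₁ (refl , e') = refl
    ... | inj₁ (refl , e) | inj₂ (_ , e') =
      ⊥-elim (p-free q' (trans (trans (sym e') h') (trans (sym h) e)))
    ... | inj₂ (_ , e) | inj₁ (refl , e') =
      ⊥-elim (p-free q (trans (trans (sym e) h) (trans (sym h') e')))
    ... | inj₂ (_ , e) | inj₂ (_ , e') = holder-injective (trans (sym e) h) (trans (sym e') h')

    accepted-above-held : ∀ (r : Fin a → Fin b → Bool) → (∀ {p' q} → T (rejected s p' q) → T (r p' q)) →
      ∀ {p' q q'} → accepted q ≡ just p' → E p' q' → prefU p' q' q → T (r p' q')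
    accepted-above-held r extends {q = q} h e pref with accepted-view q
    ... | inj₂ (_ , e') = extends (rejected-above-held (trans (sym e') h) e pref)
    ... | inj₁ (refl , e') with just-injective (trans (sym e') h)
    ...   | refl = extends (rejected-above e pref)

    accepted-keeps-others : ∀ {p' q} → q ≢ c → holder s q ≡ just p' → accepted q ≡ just p'
    accepted-keeps-others {q = q} q≢c h with accepted-view q
    ... | inj₁ (q≡c , _) = ⊥-elim (q≢c q≡c)
    ... | inj₂ (_ , e)   = trans e h

    accepted-holds : ∀ q → T (is-just (holder s q)) → T (is-just (accepted q))
    accepted-holds q held with accepted-view q
    ... | inj₁ (_ , e) rewrite e = _
    ... | inj₂ (_ , e) rewrite e = held

    accept-free : holder s c ≡ nothing → Step s
    accept-free c-free = state accepted (rejected s) , invariant , improves , ∑-mono-< c grows strict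
      where
      invariant : Invariant (state accepted (rejected s))
      invariant = record
        { held-edge = accepted-edge ; holder-injective = accepted-injective
        ; rejected-for-better = λ e r → better (rejected-for-better e r)
        ; rejected-above-held = accepted-above-held (rejected s) (λ r → r) }
        where
        better : ∀ {p' q} → ∃[ p'' ] (holder s q ≡ just p'' × prefV q p'' p') →
                 ∃[ p'' ] (accepted q ≡ just p'' × prefV q p'' p')
        better {q = q} (p'' , h , pref) with q ≟ c
        ... | yes refl with () ← trans (sym c-free) h
        ... | no q≢c   = p'' , accepted-keeps-others q≢c h , pref
      improves : Improves s (state accepted (rejected s))
      improves {q = q} h with q ≟ c
      ... | yes refl with () ← trans (sym c-free) h
      ... | no q≢c   = _ , accepted-keeps-others q≢c h , inj₁ refl
      grows : ∀ q → q ≢ c → load s q ≤ load (state accepted (rejected s)) q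
      grows q _ = +-mono-≤ (indicator-mono (accepted-holds q)) ≤-refl
      strict : load s c < load (state accepted (rejected s)) c
      strict = +-mono-<-≤ (indicator-< (subst (¬_ ∘ T ∘ is-just) (sym c-free) λ ())
                                       (subst (T ∘ is-just) (sym (updateAt-updates c (holder s))) _)) ≤-refl

    accept-displacing : ∀ {p'} → holder s c ≡ just p' → prefV c p p' → Step s
    accept-displacing {p'} held-by-p' p-better =
      s' , invariant , improves , potential-reject accepted-holds p'-fresh
      where
      s' = state accepted (reject p' c (rejected s))
      accepted-c : accepted c ≡ just p
      accepted-c = updateAt-updates c (holder s)
      invariant : Invariant s'
      invariant = record
        { held-edge = accepted-edge ; holder-injective = accepted-injective
        ; rejected-for-better = for-better
        ; rejected-above-held = accepted-above-held _ reject-keeps }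
        where
        for-better : ∀ {p₁ q} → E p₁ q → T (reject p' c (rejected s) p₁ q) →
                     ∃[ p₂ ] (accepted q ≡ just p₂ × prefV q p₂ p₁)
        for-better e r with reject-view r
        ... | inj₁ (refl , refl) = p , accepted-c , p-better
        for-better {q = q} e r | inj₂ old with rejected-for-better e old | q ≟ c
        ... | p₂ , h , pref | no q≢c = p₂ , accepted-keeps-others q≢c h , pref
        ... | p₂ , h , pref | yes refl with just-injective (trans (sym held-by-p') h)
        ...   | refl =
          p , accepted-c , IsStrictTotalOn.trans (prefV-order c) edge (held-edge held-by-p') e p-better pref
      improves : Improves s s'
      improves {q = q} h with q ≟ c
      ... | no q≢c   = _ , accepted-keeps-others q≢c h , inj₁ refl
      ... | yes refl with just-injective (trans (sym held-by-p') h)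
      ...   | refl = p , accepted-c , inj₂ p-better
      p'-fresh : ¬ T (rejected s p' c)
      p'-fresh r with rejected-for-better (held-edge held-by-p') r
      ... | p₂ , h , pref with just-injective (trans (sym held-by-p') h)
      ...   | refl = IsStrictTotalOn.irrefl (prefV-order c) (held-edge held-by-p') pref

    refuse : ∀ {p'} → holder s c ≡ just p' → ¬ prefV c p p' → Step s
    refuse {p'} held-by-p' p-worse =
      s' , invariant , Improves-refl {s} , potential-reject (λ _ held → held) fresh
      where
      s' = state (holder s) (reject p c (rejected s))
      invariant : Invariant s'
      invariant = record
        { held-edge = held-edge ; holder-injective = holder-injective
        ; rejected-for-better = for-better
        ; rejected-above-held = λ h e pref → reject-keeps (rejected-above-held h e pref) }
        where
        for-better : ∀ {p₁ q} → E p₁ q → T (reject p c (rejected s) p₁ q) →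
                     ∃[ p₂ ] (holder s q ≡ just p₂ × prefV q p₂ p₁)
        for-better e r with reject-view r
        ... | inj₂ old = rejected-for-better e old
        ... | inj₁ (refl , refl)
          with IsStrictTotalOn.connex (prefV-order c) edge (held-edge held-by-p') (λ { refl → p-free c held-by-p' })
        ...   | inj₁ p≻p' = ⊥-elim (p-worse p≻p')
        ...   | inj₂ p'≻p = p' , held-by-p' , p'≻p

    step : Step s
    step with holder s c in held
    ... | nothing = accept-free held
    ... | just p' with prefV? c p p'
    ...   | yes p-better = accept-displacing held p-better
    ...   | no p-worse   = refuse held p-worse

  unexhausted : ∀ {s p} → ¬ (∀ q → E p q → T (rejected s p q)) → ∃[ q ] (E p q × ¬ T (rejected s p q))
  unexhausted {s} {p} ¬exhausted
    with q , ¬q-rejected ← ¬∀⟶∃¬ b _ (λ q → E? p q →-dec T? (rejected s p q)) ¬exhausted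
    with E? p q
  ... | yes e  = q , e , λ r → ¬q-rejected (const r)
  ... | no ¬e  = ⊥-elim (¬q-rejected (⊥-elim ∘ ¬e))

  propose-to-best : ∀ {s} → Invariant s → ∀ {p} → (∀ q → holder s q ≢ just p) →
                    ∃[ q ] (E p q × ¬ T (rejected s p q)) → Step s
  propose-to-best {s} inv {p} p-free (_ , open-q)
    with c , (edge , fresh) , best ←
           maximal (prefU? p) (prefU-order p) (λ q → E? p q ×-dec ¬? (T? _)) proj₁ open-q
    = Propose.step inv p-free edge fresh rejected-above
    where
    rejected-above : ∀ {q} → E p q → prefU p q c → T (rejected s p q)
    rejected-above {q} e pref with T? (rejected s p q)
    ... | yes r = r
    ... | no ¬r = ⊥-elim (best (e , ¬r) pref)

  settled? : ∀ s p → Dec ((∃[ q ] holder s q ≡ just p) ⊎ (∀ q → E p q → T (rejected s p q)))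
  settled? s p =
    any? (λ q → ≡-dec _≟_ (holder s q) (just p)) ⊎-dec all? (λ q → E? p q →-dec T? (rejected s p q))

  progress : ∀ s → Invariant s → Final s ⊎ Step s
  progress s inv with all? (settled? s)
  ... | yes final = inj₁ final
  ... | no ¬final with p , unsettled ← ¬∀⟶∃¬ a _ (settled? s) ¬final =
    inj₂ (propose-to-best inv (λ q h → unsettled (inj₁ (q , h))) (unexhausted {s} (unsettled ∘ inj₂)))

  record Outcome (s₀ : State) : Set where
    field
      result    : State
      invariant : Invariant result
      final     : Final result
      improves  : Improves s₀ result

  iterate : ∀ f s → Invariant s → b * suc a < potential s + f → Outcome s
  iterate zero    s inv fuel = ⊥-elim (<⇒≱ fuel
    (≤-trans (≤-reflexive (+-identityʳ (potential s))) (potential-bounded s)))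
  iterate (suc f) s inv fuel with progress s inv
  ... | inj₁ final = record { result = s ; invariant = inv ; final = final ; improves = Improves-refl {s} }
  ... | inj₂ (s' , inv' , s≤s' , increase) =
    record { Outcome rest
           ; improves = Improves-trans inv inv' (Outcome.invariant rest) s≤s' (Outcome.improves rest) }
    where
    rest : Outcome s'
    rest = iterate f s' inv'
      (<-≤-trans fuel (≤-trans (≤-reflexive (+-suc (potential s) f)) (+-monoˡ-≤ f increase)))

  deferredAcceptance : ∀ s → Invariant s → Outcome s
  deferredAcceptance s inv =
    iterate (suc (b * suc a)) s inv (≤-trans (s≤s (m≤n+m _ (potential s))) (≤-reflexive (sym (+-suc _ _))))

  module _ {s} (inv : Invariant s) (final : Final s) where
    open Invariant inv

    final-unblocked : ∀ {p q} → E p q →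
                      holder s q ≡ just p
                      ⊎ ∃[ p' ] (holder s q ≡ just p' × prefV q p' p)
                      ⊎ ∃[ q' ] (holder s q' ≡ just p × prefU p q' q)
    final-unblocked {p} {q} e with final p
    ... | inj₂ exhausted = inj₂ (inj₁ (rejected-for-better e (exhausted q e)))
    ... | inj₁ (q' , h) with q' ≟ q
    ...   | yes refl = inj₁ h
    ...   | no q'≢q with IsStrictTotalOn.connex (prefU-order p) e (held-edge h) (q'≢q ∘ sym)
    ...     | inj₁ q≻q' = inj₂ (inj₁ (rejected-for-better e (rejected-above-held h e q≻q')))
    ...     | inj₂ q'≻q = inj₂ (inj₂ (q' , h , q'≻q))

module Antimatroid {m n : ℕ} (I : Instance m n) where
  open Instance I

  -- A stable matching of G[U' ∪ V] with V-side X, stored as V's partner function; U' is taken to be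
  -- its set of matched U-vertices.
  record StableAssignment (X : Subset n) : Set where
    field
      partner           : Fin n → Maybe (Fin m)
      partner-edge      : ∀ {u v} → partner v ≡ just u → E u v
      partner-injective : ∀ {u v v'} → partner v ≡ just u → partner v' ≡ just u → v ≡ v'
      partner-stable    : ∀ {u v v'} → partner v ≡ just u → E u v' → prefU u v' v →
                          ∃[ u' ] (partner v' ≡ just u' × prefV v' u' u)
      matched⇒∈         : ∀ {u v} → partner v ≡ just u → v ∈ X
      ∈⇒matched         : ∀ {v} → v ∈ X → ∃[ u ] partner v ≡ just u

  StableAssignment⇒𝓕 : ∀ {X} → StableAssignment X → 𝓕 I X
  StableAssignment⇒𝓕 {X} σ =
    subsetOf matched? , M , (isMatching , unblocked) , λ v → mk⇔ ∈⇒matched (matched⇒∈ ∘ proj₂)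
    where
    open StableAssignment σ
    matched? : ∀ u → Dec (∃[ v ] partner v ≡ just u)
    matched? u = any? λ v → ≡-dec _≟_ (partner v) (just u)
    M : Fin m → Fin n → Set
    M u v = partner v ≡ just u
    isMatching : IsMatching I (subsetOf matched?) M
    isMatching = record
      { edges = λ e → ∈-subsetOf⁺ matched? (_ , e) , partner-edge e
      ; uniqU = partner-injective
      ; uniqV = λ e e' → just-injective (trans (sym e) e') }
    unblocked : ∀ u v → ¬ Blocking I (subsetOf matched?) M u v
    unblocked u v ((u∈U' , edge) , u-prefers , v-prefers)
      with v₀ , e₀ ← ∈-subsetOf⁻ matched? u∈U'
      with u' , e' , u'≻u ← partner-stable e₀ edge (u-prefers v₀ e₀)
      = asym (prefV-order v) (partner-edge e') edge u'≻u (v-prefers u' e')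

  𝓕⇒StableAssignment : ∀ {X} → 𝓕 I X → StableAssignment X
  𝓕⇒StableAssignment {X} (U' , M , (isMatching , unblocked) , matches) = record
    { partner = partner ; partner-edge = edge ; partner-injective = λ e e' → uniqU (M-partner e) (M-partner e')
    ; partner-stable = stable ; matched⇒∈ = λ e → Equivalence.from (matches _) (_ , M-partner e)
    ; ∈⇒matched = λ {v} v∈X → _ , partner-M (proj₂ (Equivalence.to (matches v) v∈X)) }
    where
    open IsMatching isMatching
    partner : Fin n → Maybe (Fin m)
    partner v with v ∈? X
    ... | yes v∈X = just (proj₁ (Equivalence.to (matches v) v∈X))
    ... | no _    = nothing
    M-partner : ∀ {u v} → partner v ≡ just u → M u v
    M-partner {u} {v} e with v ∈? X
    ... | yes v∈X = subst (λ x → M x v) (just-injective e) (proj₂ (Equivalence.to (matches v) v∈X))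
    M-partner () | no _
    partner-M : ∀ {u v} → M u v → partner v ≡ just u
    partner-M {u} {v} uv with v ∈? X
    ... | yes v∈X = cong just (uniqV (proj₂ (Equivalence.to (matches v) v∈X)) uv)
    ... | no v∉X  = ⊥-elim (v∉X (Equivalence.from (matches v) (u , uv)))
    edge : ∀ {u v} → partner v ≡ just u → E u v
    edge = proj₂ ∘ edges ∘ M-partner
    blocking-unless : ∀ {u v v'} → partner v ≡ just u → E u v' → prefU u v' v → ¬ PrefersV I M u v'
    blocking-unless {u} e uv' v'≻v v'-prefers = unblocked u _
      ( (proj₁ (edges (M-partner e)) , uv')
      , (λ w uw → subst (prefU u _) (uniqU (M-partner e) uw) v'≻v)
      , v'-prefers )
    stable : ∀ {u v v'} → partner v ≡ just u → E u v' → prefU u v' v →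
             ∃[ u' ] (partner v' ≡ just u' × prefV v' u' u)
    stable {u} {v} {v'} e uv' v'≻v with partner v' in e'
    ... | nothing = ⊥-elim (blocking-unless e uv' v'≻v v'-free)
      where
      v'-free : PrefersV I M u v'
      v'-free w wv' with () ← trans (sym (partner-M wv')) e'
    ... | just u' with prefV? v' u' u
    ...   | yes u'≻u = u' , refl , u'≻u
    ...   | no u'⊁u = ⊥-elim (blocking-unless e uv' v'≻v v'-prefers)
      where
      u≢u' : u ≢ u'
      u≢u' refl = IsStrictTotalOn.irrefl (prefU-order u) uv'
        (subst (prefU u v') (uniqU (M-partner e) (M-partner e')) v'≻v)
      v'-prefers : PrefersV I M u v'
      v'-prefers w wv' with uniqV (M-partner e') wv'
      ... | refl with IsStrictTotalOn.connex (prefV-order v') uv' (edge e') u≢u'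
      ...   | inj₁ u≻u' = u≻u'
      ...   | inj₂ u'≻u = ⊥-elim (u'⊁u u'≻u)

  empty-assignment : StableAssignment Subset.⊥
  empty-assignment = record
    { partner = const nothing ; partner-edge = λ () ; partner-injective = λ () ; partner-stable = λ ()
    ; matched⇒∈ = λ () ; ∈⇒matched = λ v∈⊥ → ⊥-elim (∉⊥ v∈⊥) }

  module Union {X Y : Subset n} (σ : StableAssignment X) (τ : StableAssignment Y) where
    private
      module σ = StableAssignment σ
      module τ = StableAssignment τ

    Matched : Fin m → Set
    Matched u = (∃[ v ] σ.partner v ≡ just u) ⊎ (∃[ v ] τ.partner v ≡ just u)

    Allowed : Fin m → Fin n → Set
    Allowed u v = Matched u × E u v × v ∈ X ∪ Y × (∀ v' → E u v' → prefU u v' v → v' ∈ X ∪ Y)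

    allowed? : Decidable Allowed
    allowed? u v =
      (any? (λ v → ≡-dec _≟_ (σ.partner v) (just u)) ⊎-dec any? (λ v → ≡-dec _≟_ (τ.partner v) (just u)))
      ×-dec E? u v ×-dec (v ∈? X ∪ Y) ×-dec all? (λ v' → E? u v' →-dec prefU? u v' v →-dec (v' ∈? X ∪ Y))

    partner-allowed : ∀ {W} (ρ : StableAssignment W) → (∀ {v} → v ∈ W → v ∈ X ∪ Y) →
                      ∀ {u v} → Matched u → StableAssignment.partner ρ v ≡ just u → Allowed u v
    partner-allowed ρ W⊆X∪Y matched e = matched , partner-edge e , W⊆X∪Y (matched⇒∈ e) ,
      λ v' uv' v'≻v → W⊆X∪Y (matched⇒∈ (proj₁ (proj₂ (partner-stable e uv' v'≻v))))
      where open StableAssignment ρ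

    σ-allowed : ∀ {u v} → σ.partner v ≡ just u → Allowed u v
    σ-allowed e = partner-allowed σ (x∈p∪q⁺ ∘ inj₁) (inj₁ (_ , e)) e

    τ-allowed : ∀ {u v} → τ.partner v ≡ just u → Allowed u v
    τ-allowed e = partner-allowed τ (x∈p∪q⁺ ∘ inj₂) (inj₂ (_ , e)) e

    open DeferredAcceptance (restrictEdges I Allowed allowed? (proj₁ ∘ proj₂))

    start : State
    start = state τ.partner λ u v → ⌊ refused? u v ⌋
      where
      refused? : ∀ u v → Dec (Allowed u v × ∃[ v₀ ] (τ.partner v₀ ≡ just u × prefU u v v₀))
      refused? u v = allowed? u v ×-dec any? (λ v₀ → ≡-dec _≟_ (τ.partner v₀) (just u) ×-dec prefU? u v v₀)

    start-invariant : Invariant start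
    start-invariant = record
      { held-edge = τ-allowed ; holder-injective = τ.partner-injective
      ; rejected-for-better = λ { (_ , uv , _) r →
          let (_ , v₀ , e₀ , v≻v₀) = toWitness r in τ.partner-stable e₀ uv v≻v₀ }
      ; rejected-above-held = λ e allowed v'≻v → fromWitness (allowed , _ , e , v'≻v) }

    module _ (outcome : Outcome start) where
      open Outcome outcome
      open Invariant invariant

      private
        ν : Fin n → Maybe (Fin m)
        ν = holder result

        Upgraded : Fin m → Set
        Upgraded u = ∃[ x ] (σ.partner x ≡ just u × ∃[ w ] (ν w ≡ just u × prefU u w x))

        -- the σ-partner of u's final partner
        next : Fin m → Fin m
        next = relay ν σ.partner

        upgraded-partner : ∀ {u} → Upgraded u →
                           ∃[ w ] (ν w ≡ just u × σ.partner w ≡ just (next u) × prefV w (next u) u)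
        upgraded-partner (x , σx , w , νw , w≻x)
          with u' , σw , u'≻u ← σ.partner-stable σx (proj₁ (proj₂ (held-edge νw))) w≻x
          rewrite relay-≡ ν σ.partner holder-injective νw σw = w , νw , σw , u'≻u

        upgraded-next : ∀ {u} → Upgraded u → Upgraded (next u)
        upgraded-next = via-partner ∘ upgraded-partner
          where
          via-partner : ∀ {u} → ∃[ w ] (ν w ≡ just u × σ.partner w ≡ just (next u) × prefV w (next u) u) →
                        Upgraded (next u)
          via-partner (w , νw , σw , u'≻u) with final-unblocked invariant final (σ-allowed σw)
          ... | inj₁ νw' = ⊥-elim (IsStrictTotalOn.irrefl (prefV-order w) (proj₁ (proj₂ (held-edge νw)))
                             (subst (λ x → prefV w x _) (just-injective (trans (sym νw') νw)) u'≻u))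
          ... | inj₂ (inj₁ (u'' , νw' , u''≻u')) with refl ← just-injective (trans (sym νw) νw') =
            ⊥-elim (asym (prefV-order w) (σ.partner-edge σw) (proj₁ (proj₂ (held-edge νw))) u'≻u u''≻u')
          ... | inj₂ (inj₂ (w' , νw' , w'≻w)) = w , σw , w' , νw' , w'≻w

        next-injective : ∀ {u u'} → Upgraded u → Upgraded u' → next u ≡ next u' → u ≡ u'
        next-injective up up' eq
          with w , νw , σw , _ ← upgraded-partner up | w' , νw' , σw' , _ ← upgraded-partner up'
          with refl ← σ.partner-injective σw (trans σw' (cong just (sym eq)))
          = just-injective (trans (sym νw) νw')

      -- An unmatched x ∈ X would leave its σ-partner upgraded and outside the image of next.
      X-matched : ∀ {x} → x ∈ X → ∃[ u ] ν x ≡ just u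
      X-matched {x} x∈X with σ.∈⇒matched x∈X
      ... | u₁ , σx with ν x in νx
      ...   | just u = u , refl
      ...   | nothing =
        ⊥-elim (injectiveOn-omits-nothing next upgraded-next next-injective u₁-upgraded misses-u₁)
        where
        u₁-upgraded : Upgraded u₁
        u₁-upgraded with final-unblocked invariant final (σ-allowed σx)
        ... | inj₁ νx' with () ← trans (sym νx) νx'
        ... | inj₂ (inj₁ (_ , νx' , _)) with () ← trans (sym νx) νx'
        ... | inj₂ (inj₂ (w , νw , w≻x)) = x , σx , w , νw , w≻x
        misses-u₁ : ∀ {u} → Upgraded u → next u ≢ u₁
        misses-u₁ up eq with w , νw , σw , _ ← upgraded-partner up
          with refl ← σ.partner-injective σw (trans σx (cong just (sym eq)))
          with () ← trans (sym νx) νw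

      union-assignment : StableAssignment (X ∪ Y)
      union-assignment = record
        { partner = ν ; partner-edge = proj₁ ∘ proj₂ ∘ held-edge ; partner-injective = holder-injective
        ; partner-stable = stable ; matched⇒∈ = proj₁ ∘ proj₂ ∘ proj₂ ∘ held-edge ; ∈⇒matched = matched }
        where
        -- Everything u prefers to an allowed partner is itself allowed, so u has been refused there.
        stable : ∀ {u v v'} → ν v ≡ just u → E u v' → prefU u v' v →
                 ∃[ u' ] (ν v' ≡ just u' × prefV v' u' u)
        stable {u} e uv' v'≻v with matched , _ , _ , above-in-X∪Y ← held-edge e =
          rejected-for-better allowed (rejected-above-held e allowed v'≻v)
          where
          allowed : Allowed u _
          allowed = matched , uv' , above-in-X∪Y _ uv' v'≻v , λ v'' uv'' v''≻v' →
            above-in-X∪Y v'' uv''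
              (IsStrictTotalOn.trans (prefU-order u) uv'' uv' (proj₁ (proj₂ (held-edge e))) v''≻v' v'≻v)
        matched : ∀ {v} → v ∈ X ∪ Y → ∃[ u ] ν v ≡ just u
        matched {v} v∈X∪Y with x∈p∪q⁻ X Y v∈X∪Y
        ... | inj₁ v∈X = X-matched v∈X
        ... | inj₂ v∈Y with u , e , _ ← improves (proj₂ (τ.∈⇒matched v∈Y)) = u , e

    union : StableAssignment (X ∪ Y)
    union = union-assignment (deferredAcceptance start start-invariant)

  module Removal {X : Subset n} (σ : StableAssignment X) {v₀ : Fin n} (v₀∈X : v₀ ∈ X) where
    private
      module σ = StableAssignment σ

    u₀ : Fin m
    u₀ = proj₁ (σ.∈⇒matched v₀∈X)

    σv₀ : σ.partner v₀ ≡ just u₀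
    σv₀ = proj₂ (σ.∈⇒matched v₀∈X)

    -- V proposes and U receives.
    Allowed : Fin n → Fin m → Set
    Allowed v u = E u v × (∃[ v' ] σ.partner v' ≡ just u) × u ≢ u₀ × (∃[ u' ] σ.partner v ≡ just u')

    allowed? : Decidable Allowed
    allowed? v u = E? u v ×-dec any? (λ v' → ≡-dec _≟_ (σ.partner v') (just u)) ×-dec ¬? (u ≟ u₀)
      ×-dec any? (λ u' → ≡-dec _≟_ (σ.partner v) (just u'))

    open DeferredAcceptance (swap (restrictEdges I (λ u v → Allowed v u) (λ u v → allowed? v u) proj₁))

    start-holder : Fin m → Maybe (Fin n)
    start-holder u with u ≟ u₀
    ... | yes _ = nothing
    ... | no _  = partialInverse σ.partner u

    start-holder-sound : ∀ {u v} → start-holder u ≡ just v → u ≢ u₀ × σ.partner v ≡ just u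
    start-holder-sound {u} e with u ≟ u₀
    ... | no u≢u₀ = u≢u₀ , partialInverse-sound σ.partner e

    start-holder-complete : ∀ {u v} → u ≢ u₀ → σ.partner v ≡ just u → start-holder u ≡ just v
    start-holder-complete {u} u≢u₀ e with u ≟ u₀
    ... | yes u≡u₀ = ⊥-elim (u≢u₀ u≡u₀)
    ... | no _     = partialInverse-complete σ.partner σ.partner-injective e

    start : State
    start = state start-holder λ v u → ⌊ refused? v u ⌋
      where
      refused? : ∀ v u → Dec (Allowed v u × ∃[ u₁ ] (σ.partner v ≡ just u₁ × prefV v u u₁))
      refused? v u = allowed? v u ×-dec any? (λ u₁ → ≡-dec _≟_ (σ.partner v) (just u₁) ×-dec prefV? v u u₁)

    start-invariant : Invariant start
    start-invariant = record
      { held-edge = held-edge ; holder-injective = holder-injective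
      ; rejected-for-better = for-better
      ; rejected-above-held = λ e allowed u'≻u →
          fromWitness (allowed , _ , proj₂ (start-holder-sound e) , u'≻u) }
      where
      held-edge : ∀ {v u} → start-holder u ≡ just v → Allowed v u
      held-edge e with u≢u₀ , σv ← start-holder-sound e = σ.partner-edge σv , (_ , σv) , u≢u₀ , (_ , σv)
      holder-injective : ∀ {v u u'} → start-holder u ≡ just v → start-holder u' ≡ just v → u ≡ u'
      holder-injective e e' =
        just-injective (trans (sym (proj₂ (start-holder-sound e))) (proj₂ (start-holder-sound e')))
      for-better : ∀ {v u} → Allowed v u → T (rejected start v u) →
                   ∃[ v' ] (start-holder u ≡ just v' × prefU u v' v)
      for-better {v} {u} (uv , (v' , σv') , u≢u₀ , _) r
        with u₁ , σv , u≻u₁ ← proj₂ (toWitness r) = v' , start-holder-complete u≢u₀ σv' , v'≻v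
        where
        v≢v' : v ≢ v'
        v≢v' refl = IsStrictTotalOn.irrefl (prefV-order v) uv
          (subst (prefV v u) (just-injective (trans (sym σv) σv')) u≻u₁)
        v'≻v : prefU u v' v
        v'≻v with IsStrictTotalOn.connex (prefU-order u) (σ.partner-edge σv') uv (v≢v' ∘ sym)
        ... | inj₁ v'≻v = v'≻v
        ... | inj₂ v≻v' with u'' , σv'' , u''≻u ← σ.partner-stable σv' uv v≻v'
          with refl ← just-injective (trans (sym σv) σv'') =
          ⊥-elim (asym (prefV-order v) uv (σ.partner-edge σv) u≻u₁ u''≻u)

    module _ (outcome : Outcome start) where
      open Outcome outcome
      open Invariant invariant

      private
        μ : Fin m → Maybe (Fin n)
        μ = holder result

        π : Fin n → Maybe (Fin m)
        π = partialInverse μ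

        π-sound : ∀ {u v} → π v ≡ just u → μ u ≡ just v
        π-sound = partialInverse-sound μ

        π-complete : ∀ {u v} → μ u ≡ just v → π v ≡ just u
        π-complete = partialInverse-complete μ holder-injective

        π-injective : ∀ {u v v'} → π v ≡ just u → π v' ≡ just u → v ≡ v'
        π-injective e e' = just-injective (trans (sym (π-sound e)) (π-sound e'))

        Rematched : Fin n → Set
        Rematched v = ∃[ u ] π v ≡ just u

        rematched? : ∀ v → Dec (Rematched v)
        rematched? v = any? λ u → ≡-dec _≟_ (π v) (just u)

        π-in-X : ∀ {u v} → π v ≡ just u → v ∈ X
        π-in-X e with _ , _ , _ , (_ , σv) ← held-edge (π-sound e) = σ.matched⇒∈ σv

        π-stable : ∀ {u v v'} → π v ≡ just u → E u v' → prefU u v' v →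
                   ∃[ u' ] (π v' ≡ just u' × prefV v' u' u)
        π-stable {u} {v} {v'} e uv' v'≻v with held-edge (π-sound e)
        ... | uv , (v₁ , σv₁) , u≢u₀ , _ with σ.partner v' in σv'
        ...   | just u₁ with final-unblocked invariant final (uv' , (v₁ , σv₁) , u≢u₀ , (u₁ , σv'))
        ...     | inj₁ μu with refl ← just-injective (trans (sym (π-sound e)) μu) =
          ⊥-elim (IsStrictTotalOn.irrefl (prefU-order u) uv v'≻v)
        ...     | inj₂ (inj₁ (_ , μu , v≻v')) with refl ← just-injective (trans (sym (π-sound e)) μu) =
          ⊥-elim (asym (prefU-order u) uv' uv v'≻v v≻v')
        ...     | inj₂ (inj₂ (u' , μu' , u'≻u)) = u' , π-complete μu' , u'≻u
        π-stable {u} {v} {v'} e uv' v'≻v | uv , (v₁ , σv₁) , u≢u₀ , _ | nothing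
          with v₂ , μu , v₂≽v₁ ← improves (start-holder-complete u≢u₀ σv₁)
          with refl ← just-injective (trans (sym (π-sound e)) μu)
          = ⊥-elim (asym (prefU-order u) uv' uv v'≻v (v≽v₁⇒v≻v' v₂≽v₁))
          where
          -- v' is σ-unmatched, so by σ's stability u's σ-partner v₁ beats v'.
          v₁≻v' : prefU u v₁ v'
          v₁≻v' with IsStrictTotalOn.connex (prefU-order u) (σ.partner-edge σv₁) uv'
                       (λ { refl → contradiction (trans (sym σv₁) σv') λ () })
          ... | inj₁ v₁≻v' = v₁≻v'
          ... | inj₂ v'≻v₁ with _ , σv'' , _ ← σ.partner-stable σv₁ uv' v'≻v₁
            with () ← trans (sym σv') σv''
          v≽v₁⇒v≻v' : v ≡ v₁ ⊎ prefU u v v₁ → prefU u v v'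
          v≽v₁⇒v≻v' (inj₁ refl) = v₁≻v'
          v≽v₁⇒v≻v' (inj₂ v≻v₁) =
            IsStrictTotalOn.trans (prefU-order u) uv (σ.partner-edge σv₁) uv' v≻v₁ v₁≻v'

        -- If all of X stayed matched, u ↦ π(σ⁻¹ u) would inject the σ-matched vertices into themselves
        -- minus u₀.
        some-unmatched : ∃[ e ] (e ∈ X × ¬ Rematched e)
        some-unmatched with any? (λ v → (v ∈? X) ×-dec ¬? (rematched? v))
        ... | yes found = found
        ... | no ∄unmatched =
          ⊥-elim (injectiveOn-omits-nothing next next-matched next-injective (v₀ , σv₀) next≢u₀)
          where
          rematched : ∀ {v} → v ∈ X → Rematched v
          rematched {v} v∈X with rematched? v
          ... | yes r = r
          ... | no ¬r = ⊥-elim (∄unmatched (v , v∈X , ¬r))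
          next : Fin m → Fin m
          next = relay σ.partner π
          σ-Matched : Fin m → Set
          σ-Matched u = ∃[ v ] σ.partner v ≡ just u
          next-partner : ∀ {u} → σ-Matched u → ∃[ v ] (σ.partner v ≡ just u × π v ≡ just (next u))
          next-partner (v , σv) with u' , πv ← rematched (σ.matched⇒∈ σv)
            rewrite relay-≡ σ.partner π σ.partner-injective σv πv = v , σv , πv
          next-matched : ∀ {u} → σ-Matched u → σ-Matched (next u)
          next-matched m with v , _ , πv ← next-partner m = proj₁ (proj₂ (held-edge (π-sound πv)))
          next-injective : ∀ {u u'} → σ-Matched u → σ-Matched u' → next u ≡ next u' → u ≡ u'
          next-injective m m' eq with v , σv , πv ← next-partner m | v' , σv' , πv' ← next-partner m'
            with refl ← π-injective πv (trans πv' (cong just (sym eq)))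
            = just-injective (trans (sym σv) σv')
          next≢u₀ : ∀ {u} → σ-Matched u → next u ≢ u₀
          next≢u₀ m with _ , _ , πv ← next-partner m = proj₁ (proj₂ (proj₂ (held-edge (π-sound πv))))

      e : Fin n
      e = proj₁ some-unmatched

      e∈X : e ∈ X
      e∈X = proj₁ (proj₂ some-unmatched)

      private
        e-unmatched : ¬ Rematched e
        e-unmatched = proj₂ (proj₂ some-unmatched)

        -- Sending v₀ to e and every other v to the final partner of its σ-partner injects X into
        -- itself, missing any unmatched vertex other than e.
        unmatched-unique : ∀ {v'} → v' ∈ X → ¬ Rematched v' → v' ≡ e
        unmatched-unique {v'} v'∈X v'-unmatched with v' ≟ e
        ... | yes v'≡e = v'≡e
        ... | no v'≢e =
          ⊥-elim (injectiveOn-omits-nothing shift shift-closed shift-injective v'∈X shift-misses)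
          where
          shift : Fin n → Fin n
          shift v with v ≟ v₀
          ... | yes _ = e
          ... | no _  = fromMaybe v (σ.partner v >>= μ)

          ShiftView : Fin n → Set
          ShiftView v = (v ≡ v₀ × shift v ≡ e) ⊎ ∃[ u ] (σ.partner v ≡ just u × μ u ≡ just (shift v))

          shift-view : ∀ {v} → v ∈ X → ShiftView v
          shift-view {v} v∈X with v ≟ v₀
          ... | yes v≡v₀ = inj₁ (v≡v₀ , refl)
          ... | no v≢v₀ with u , σv ← σ.∈⇒matched v∈X
            with _ , μu , _ ←
                   improves (start-holder-complete (λ { refl → v≢v₀ (σ.partner-injective σv σv₀) }) σv)
            = inj₂ (u , σv , trans μu (cong just (sym shift≡)))
            where
            shift≡ : fromMaybe v (σ.partner v >>= μ) ≡ _
            shift≡ = trans (cong (λ x → fromMaybe v (x >>= μ)) σv) (cong (fromMaybe v) μu)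

          shift-closed : ∀ {v} → v ∈ X → shift v ∈ X
          shift-closed v∈X with shift-view v∈X
          ... | inj₁ (_ , shift≡e) = subst (_∈ X) (sym shift≡e) e∈X
          ... | inj₂ (_ , _ , μu)  = π-in-X (π-complete μu)

          e-not-held : ∀ {u} → μ u ≢ just e
          e-not-held μu = e-unmatched (_ , π-complete μu)

          shift-injective : ∀ {v v''} → v ∈ X → v'' ∈ X → shift v ≡ shift v'' → v ≡ v''
          shift-injective v∈X v''∈X eq with shift-view v∈X | shift-view v''∈X
          ... | inj₁ (v≡v₀ , _) | inj₁ (v''≡v₀ , _) = trans v≡v₀ (sym v''≡v₀)
          ... | inj₁ (_ , shift≡e) | inj₂ (_ , _ , μu) =
            ⊥-elim (e-not-held (trans μu (cong just (trans (sym eq) shift≡e))))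
          ... | inj₂ (_ , _ , μu) | inj₁ (_ , shift≡e) =
            ⊥-elim (e-not-held (trans μu (cong just (trans eq shift≡e))))
          ... | inj₂ (u , σv , μu) | inj₂ (u'' , σv'' , μu'')
            with refl ← holder-injective μu (trans μu'' (cong just (sym eq))) = σ.partner-injective σv σv''

          shift-misses : ∀ {v} → v ∈ X → shift v ≢ v'
          shift-misses v∈X shift≡v' with shift-view v∈X
          ... | inj₁ (_ , shift≡e) = v'≢e (trans (sym shift≡v') shift≡e)
          ... | inj₂ (_ , _ , μu)  =
            v'-unmatched (_ , π-complete (subst (λ x → μ _ ≡ just x) shift≡v' μu))

      removal-assignment : StableAssignment (X - e)
      removal-assignment = record
        { partner = π ; partner-edge = proj₁ ∘ held-edge ∘ π-sound ; partner-injective = π-injective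
        ; partner-stable = π-stable
        ; matched⇒∈ = λ πv → x∈p∧x≢y⇒x∈p-y (π-in-X πv) λ { refl → e-unmatched (_ , πv) }
        ; ∈⇒matched = matched }
        where
        matched : ∀ {v} → v ∈ X - e → Rematched v
        matched {v} v∈X-e with rematched? v
        ... | yes r = r
        ... | no ¬r = ⊥-elim (x∈p-y⇒x≢y v∈X-e (unmatched-unique (p─q⊆p X _ v∈X-e) ¬r))

    removal : ∃[ e ] (e ∈ X × StableAssignment (X - e))
    removal = e outcome , e∈X outcome , removal-assignment outcome
      where outcome = deferredAcceptance start start-invariant

theorem1 : (m n : ℕ) (I : Instance m n) → IsAntimatroid (𝓕 I)
theorem1 m n I = record
  { nonempty     = Subset.⊥ , StableAssignment⇒𝓕 empty-assignment
  ; accessible   = λ X X∈𝓕 (_ , v₀∈X) →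
      let e , e∈X , ρ = Removal.removal (𝓕⇒StableAssignment X∈𝓕) v₀∈X in e , e∈X , StableAssignment⇒𝓕 ρ
  ; union-closed = λ X Y X∈𝓕 Y∈𝓕 →
      StableAssignment⇒𝓕 (Union.union (𝓕⇒StableAssignment X∈𝓕) (𝓕⇒StableAssignment Y∈𝓕))
  }
  where open Antimatroid I
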